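{- Let $k$ be a positive integer and let $\mu,\lambda$ be integer partitions of $k$, both different from $1^k=(1,1,\dots,1)$. For a partition $\nu\neq 1^k$ of $k$, let $\varsigma_\nu$ denote the smallest part of $\nu$ not equal to $1$. Then $\mu\preceq\lambda$ if and only if $\mu$ is coarser than $\lambda$ (in refinement order on integer partitions) and $\varsigma_\mu\geqslant\varsigma_\lambda$.
   Context: A set partition of a finite set $X$ is a set of nonempty pairwise disjoint subsets (blocks) of $X$ whose union is $X$; its type is the integer partition obtained by sorting the block sizes in weakly decreasing order. For set partitions of $[k]=\{1,\dots,k\}$, $\pi\vee\tau$ denotes their join in the refinement order (the finest set partition coarser than both). For integer partitions $\mu,\lambda$ of $k$, define $\mu \preceq \lambda$ if there exist an integer $\ell\ge0$ and set partitions $\pi_0,\dots,\pi_\ell$ of $[k]$, each of type $\lambda$, such that $\pi_0\vee\cdots\vee\pi_\ell$ has type $\mu$. An integer partition $\mu$ is coarser than $\lambda=(\lambda_1,\dots,\lambda_r)$ if there is a set partition $\{I_1,\dots,I_d\}$ of $[r]$ such that $\mu$ is the weakly decreasing rearrangement of $(\sum_{i\in I_1}\lambda_i,\dots,\sum_{i\in I_d}\lambda_i)$. -}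

module Defs where

open import Data.Nat using (ℕ; zero; suc; _+_; _≤_; _≥_; _<_; _⊓_; _≟_)
open import Data.Fin using (Fin)
import Data.Fin as F
open import Data.List using (List; []; _∷_; length; filter; map; replicate; foldr)
open import Data.Nat.ListAction using (sum)
open import Data.List.Relation.Unary.All using (All)
open import Data.List.Relation.Unary.Linked using (Linked)
open import Data.List.Relation.Binary.Permutation.Propositional using (_↭_)
open import Data.Product using (Σ; _×_; ∃; ∃-syntax)
open import Relation.Binary.PropositionalEquality using (_≡_; _≢_)
open import Relation.Nullary using (¬_; yes; no)
open import Relation.Unary using () renaming (∁ to ∁)
open import Data.Fin using () renaming (_≟_ to _≟F_)
open import Data.List.Base using (allFin)

IsPartition : ℕ → List ℕ → Set
IsPartition k μ = Linked _≥_ μ × All (λ x → 0 < x) μ × sum μ ≡ k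

ones : ℕ → List ℕ
ones k = replicate k 1

-- A set partition of a finite set Fin n is represented by a block labelling
-- f : Fin n → Fin n ; the blocks are the nonempty fibres of f.
SetPartition : ℕ → Set
SetPartition n = Fin n → Fin n

Refines : ∀ {n} → SetPartition n → SetPartition n → Set
Refines {n} π σ = ∀ (i j : Fin n) → π i ≡ π j → σ i ≡ σ j

IsJoin : ∀ {n m} → (Fin m → SetPartition n) → SetPartition n → Set
IsJoin {n} {m} πs σ =
  (∀ (a : Fin m) → Refines (πs a) σ) ×
  (∀ (τ : SetPartition n) → (∀ (a : Fin m) → Refines (πs a) τ) → Refines σ τ)

fibreSize : ∀ {n} → SetPartition n → Fin n → ℕ
fibreSize {n} f c = length (filter (λ i → f i ≟F c) (allFin n))

nonzero : List ℕ → List ℕ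
nonzero = filter (λ x → Relation.Nullary.¬? (x ≟ 0))
  where import Relation.Nullary

blockSizes : ∀ {n} → SetPartition n → List ℕ
blockSizes {n} f = nonzero (map (fibreSize f) (allFin n))

HasType : ∀ {n} → SetPartition n → List ℕ → Set
HasType f μ = Linked _≥_ μ × (μ ↭ blockSizes f)

_≼_ : ∀ {k : ℕ} → List ℕ → List ℕ → Set
_≼_ {k} μ λ' =
  ∃[ ℓ ] Σ (Fin (suc ℓ) → SetPartition k) λ πs →
    (∀ a → HasType (πs a) λ') ×
    Σ (SetPartition k) λ σ → IsJoin πs σ × HasType σ μ

at : (xs : List ℕ) → Fin (length xs) → ℕ
at xs = Data.List.lookup xs
  where import Data.List

-- μ is coarser than λ: there is a set partition {I_1..I_d} of [r] (r = length λ),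
-- given as a labelling g, such that μ is the decreasing rearrangement of the
-- block sums.  (Parts of λ are positive, so nonempty blocks are exactly those
-- with nonzero sum.)
Coarser : List ℕ → List ℕ → Set
Coarser μ λ' =
  Σ (SetPartition (length λ')) λ g →
    Linked _≥_ μ ×
    (μ ↭ nonzero (map (λ c → sum (map (at λ') (filter (λ i → g i ≟F c) (allFin (length λ')))))
                      (allFin (length λ'))))

-- smallest part of ν not equal to 1 (0 if there is none; parts are positive)
smallestNon1 : List ℕ → ℕ
smallestNon1 = foldr step 0
  where
  step : ℕ → ℕ → ℕ
  step x r with x ≟ 1
  ... | yes _ = r
  ... | no _ with r
  ...   | zero = x
  ...   | suc r' = x ⊓ suc r'

-- Necessity. Every block of the join σ is a union of blocks of each πₐ, so μ is coarser
-- than λ. A block of σ with at least two points contains two points identified by some πₐ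
-- (otherwise splitting that block into singletons gives a smaller upper bound), hence a
-- non-singleton block of πₐ; so ς_λ is at most the size of every non-singleton block of σ.
--
-- Sufficiency. Realise λ by π₀, whose blocks are consecutive intervals, and let σ unite the
-- intervals as prescribed by the coarsening, so that σ has type μ. For every pair i, j in a
-- block of σ we build a partition of type λ refining σ that identifies i and j: if the block
-- contains a non-singleton block of π₀, two of its points are moved onto i and j by
-- transpositions inside the block; otherwise the block consists of π₀-singletons and has size
-- at least ς_μ ≥ ς_λ, so a π₀-block of size ς_λ can first be exchanged into it. The join of
-- π₀ and all these partitions is σ.

module Submission where

open import Defs
open import Data.Bool using (true; false; if_then_else_)
open import Data.Empty using (⊥-elim)
open import Data.Fin as Fin using (Fin; zero; suc; inject≤; punchIn; punchOut; _↑ˡ_; _↑ʳ_; splitAt; toℕ; remQuot; combine)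
open import Data.Fin.Properties
  using (any?; all?; inject≤-injective; punchIn-punchOut; punchIn-injective; pigeonhole; splitAt-↑ˡ; splitAt-↑ʳ; remQuot-combine; suc-injective)
open import Data.Fin.Permutation using (Permutation; permutation; _⟨$⟩ʳ_; transpose)
import Data.Fin.Permutation.Components as PC
open import Data.List using (List; []; _∷_; length; filter; map; tabulate; allFin)
open import Data.List.Properties using (map-tabulate; tabulate-cong; tabulate-lookup; filter-accept; filter-reject)
open import Data.List.Membership.Propositional using (_∈_)
open import Data.List.Membership.Propositional.Properties using (∈-tabulate⁻; ∈-tabulate⁺; ∈-filter⁻; ∈-filter⁺)
open import Data.List.Relation.Binary.Permutation.Propositional as ↭ using (_↭_; ↭-sym; ↭-trans; ↭-reflexive)
open import Data.List.Relation.Binary.Permutation.Propositional.Properties using (∈-resp-↭)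
open import Data.List.Relation.Unary.All as All using (All; []; _∷_)
open import Data.List.Relation.Unary.All.Properties using (¬All⇒Any¬)
open import Data.List.Relation.Unary.Any as Any using (Any; here; there)
open import Data.List.Relation.Unary.Any.Properties using (lookup-index)
open import Data.List.Relation.Unary.Linked using (Linked)
open import Data.Nat using (ℕ; zero; suc; _+_; _*_; _≤_; _<_; _≥_; z≤n; s≤s; _≟_; _≤?_)
open import Data.Nat.ListAction using (sum)
open import Data.Nat.Properties hiding (suc-injective)
open import Data.Product using (Σ; _×_; _,_; proj₁; proj₂; ∃; ∃₂)
open import Data.Sum using (inj₁; inj₂; [_,_]′)
open import Function using (_∘_; id; const)
open import Function.Bundles using (_⇔_; mk⇔)
open import Relation.Binary.PropositionalEquality hiding ([_])
open import Relation.Nullary using (¬_; Dec; yes; no; does; ¬?)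
open import Relation.Nullary.Decidable using (dec-true; dec-false; _×-dec_)

open import Algebra.Properties.CommutativeSemigroup +-commutativeSemigroup using (x∙yz≈y∙xz)
open import Algebra.Properties.CommutativeMonoid.Sum +-0-commutativeMonoid using (sum-cong-≗; ∑-comm; sum-permute) renaming (sum to ∑)

-- Sums over Fin n and fibres of maps

δ : ∀ {n} → Fin n → Fin n → ℕ → ℕ
δ a b v = if does (a Fin.≟ b) then v else 0

δ-≡ : ∀ {n} {a b : Fin n} v → a ≡ b → δ a b v ≡ v
δ-≡ {a = a} {b} v a≡b rewrite dec-true (a Fin.≟ b) a≡b = refl

δ-≢ : ∀ {n} {a b : Fin n} v → a ≢ b → δ a b v ≡ 0
δ-≢ {a = a} {b} v a≢b rewrite dec-false (a Fin.≟ b) a≢b = refl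

δ-zero : ∀ {n} (a b : Fin n) → δ a b 0 ≡ 0
δ-zero a b with does (a Fin.≟ b)
... | true  = refl
... | false = refl

δ-cong : ∀ {m n} {a b : Fin m} {c d : Fin n} v → (a ≡ b → c ≡ d) → (c ≡ d → a ≡ b) → δ a b v ≡ δ c d v
δ-cong {a = a} {b} v to from with a Fin.≟ b
... | yes a≡b = sym (δ-≡ v (to a≡b))
... | no  a≢b = sym (δ-≢ v (a≢b ∘ from))

δ-sym : ∀ {n} (a b : Fin n) v → δ a b v ≡ δ b a v
δ-sym a b v = δ-cong {c = b} {a} v sym sym

δ-comm : ∀ {m n} (a b : Fin m) (c d : Fin n) v → δ a b (δ c d v) ≡ δ c d (δ a b v)
δ-comm a b c d v with does (a Fin.≟ b) | does (c Fin.≟ d)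
... | true  | true  = refl
... | true  | false = refl
... | false | true  = refl
... | false | false = refl

∑-zero : ∀ {n} (f : Fin n → ℕ) → (∀ x → f x ≡ 0) → ∑ f ≡ 0
∑-zero {zero}  f f≡0 = refl
∑-zero {suc n} f f≡0 rewrite f≡0 zero = ∑-zero (f ∘ suc) (f≡0 ∘ suc)

∑-mono : ∀ {n} {f g : Fin n → ℕ} → (∀ x → f x ≤ g x) → ∑ f ≤ ∑ g
∑-mono {zero}  f≤g = z≤n
∑-mono {suc n} f≤g = +-mono-≤ (f≤g zero) (∑-mono (f≤g ∘ suc))

∑-const : ∀ n v → ∑ {n} (const v) ≡ n * v
∑-const zero    v = refl
∑-const (suc n) v = cong (v +_) (∑-const n v)

∑-splitAt : ∀ m n (f : Fin (m + n) → ℕ) → ∑ f ≡ ∑ (λ i → f (i ↑ˡ n)) + ∑ (λ j → f (m ↑ʳ j))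
∑-splitAt zero    n f = refl
∑-splitAt (suc m) n f = trans (cong (f zero +_) (∑-splitAt m n (f ∘ suc))) (sym (+-assoc (f zero) _ _))

∑-δ : ∀ {m n} (c d : Fin m) (f : Fin n → ℕ) → ∑ (λ x → δ c d (f x)) ≡ δ c d (∑ f)
∑-δ c d f with does (c Fin.≟ d)
... | true  = refl
... | false = ∑-zero (λ x → if false then f x else 0) (λ _ → refl)

∑-δ-at : ∀ {n} (t : Fin n) (w : Fin n → ℕ) → ∑ (λ x → δ x t (w x)) ≡ w t
∑-δ-at zero    w = trans (cong (w zero +_) (∑-zero _ (λ x → δ-≢ {a = suc x} {zero} (w (suc x)) λ ()))) (+-identityʳ _)
∑-δ-at (suc t) w = ∑-δ-at t (w ∘ suc)

fibreSum : ∀ {n m} → (Fin n → ℕ) → (Fin n → Fin m) → Fin m → ℕ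
fibreSum w f c = ∑ (λ x → δ (f x) c (w x))

fibreCard : ∀ {n m} → (Fin n → Fin m) → Fin m → ℕ
fibreCard = fibreSum (const 1)

fibreSum-cong : ∀ {n m} {w w' : Fin n → ℕ} {f f' : Fin n → Fin m} → w ≗ w' → f ≗ f' → fibreSum w f ≗ fibreSum w' f'
fibreSum-cong w≗w' f≗f' c = sum-cong-≗ (λ x → cong₂ (λ a v → δ a c v) (f≗f' x) (w≗w' x))

fibreSum-outsideImage : ∀ {n m} (w : Fin n → ℕ) (f : Fin n → Fin m) c → (∀ x → f x ≢ c) → fibreSum w f c ≡ 0
fibreSum-outsideImage w f c c∉f = ∑-zero _ (λ x → δ-≢ (w x) (c∉f x))

fibreSum-injective : ∀ {n m m'} (w : Fin n → ℕ) (f : Fin n → Fin m) (ι : Fin m → Fin m') →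
                     (∀ {a b} → ι a ≡ ι b → a ≡ b) → ∀ c → fibreSum w (ι ∘ f) (ι c) ≡ fibreSum w f c
fibreSum-injective w f ι ι-inj c = sum-cong-≗ (λ x → sym (δ-cong (w x) (cong ι) ι-inj))

fibreSum-∘ : ∀ {n m l} (w : Fin n → ℕ) (f : Fin n → Fin m) (h : Fin m → Fin l) d →
             fibreSum w (h ∘ f) d ≡ fibreSum (fibreSum w f) h d
fibreSum-∘ w f h d = begin
  ∑ (λ x → δ (h (f x)) d (w x))
    ≡⟨ sum-cong-≗ (λ x → sym (∑-δ-at (f x) (λ y → δ (h y) d (w x)))) ⟩
  ∑ (λ x → ∑ (λ y → δ y (f x) (δ (h y) d (w x))))
    ≡⟨ ∑-comm (λ x y → δ y (f x) (δ (h y) d (w x))) ⟩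
  ∑ (λ y → ∑ (λ x → δ y (f x) (δ (h y) d (w x))))
    ≡⟨ sum-cong-≗ (λ y → sum-cong-≗ (λ x →
         trans (δ-comm y (f x) (h y) d (w x)) (cong (δ (h y) d) (δ-sym y (f x) (w x))))) ⟩
  ∑ (λ y → ∑ (λ x → δ (h y) d (δ (f x) y (w x))))
    ≡⟨ sum-cong-≗ (λ y → ∑-δ (h y) d (λ x → δ (f x) y (w x))) ⟩
  fibreSum (fibreSum w f) h d ∎
  where open ≡-Reasoning

fibreCard-pos : ∀ {n m} (f : Fin n → Fin m) {c} i → f i ≡ c → 1 ≤ fibreCard f c
fibreCard-pos f zero    fi≡c rewrite δ-≡ {a = f zero} 1 fi≡c = s≤s z≤n
fibreCard-pos f (suc i) fi≡c = ≤-trans (fibreCard-pos (f ∘ suc) i fi≡c) (m≤n+m _ _)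

fibreCard-≥2 : ∀ {n m} (f : Fin n → Fin m) {c} {i j} → i ≢ j → f i ≡ c → f j ≡ c → 2 ≤ fibreCard f c
fibreCard-≥2 f {i = zero}  {zero}  i≢j _ _ = ⊥-elim (i≢j refl)
fibreCard-≥2 f {i = zero}  {suc j} _ fi≡c fj≡c rewrite δ-≡ {a = f zero} 1 fi≡c = s≤s (fibreCard-pos (f ∘ suc) j fj≡c)
fibreCard-≥2 f {i = suc i} {zero}  _ fi≡c fj≡c rewrite δ-≡ {a = f zero} 1 fj≡c = s≤s (fibreCard-pos (f ∘ suc) i fi≡c)
fibreCard-≥2 f {i = suc i} {suc j} i≢j fi≡c fj≡c =
  ≤-trans (fibreCard-≥2 (f ∘ suc) (i≢j ∘ cong suc) fi≡c fj≡c) (m≤n+m _ _)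

fibreCard-pos⁻ : ∀ {n m} (f : Fin n → Fin m) c → 1 ≤ fibreCard f c → ∃ λ i → f i ≡ c
fibreCard-pos⁻ {zero}  f c ()
fibreCard-pos⁻ {suc n} f c 1≤ with f zero Fin.≟ c
... | yes f0≡c = zero , f0≡c
... | no  _    = let i , fi≡c = fibreCard-pos⁻ (f ∘ suc) c 1≤ in suc i , fi≡c

fibreCard-≥2⁻ : ∀ {n m} (f : Fin n → Fin m) c → 2 ≤ fibreCard f c → ∃₂ λ i j → i ≢ j × f i ≡ c × f j ≡ c
fibreCard-≥2⁻ {zero}  f c ()
fibreCard-≥2⁻ {suc n} f c 2≤ with f zero Fin.≟ c
... | yes f0≡c = let j , fj≡c = fibreCard-pos⁻ (f ∘ suc) c (≤-pred 2≤) in zero , suc j , (λ ()) , f0≡c , fj≡c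
... | no  _    = let i , j , i≢j , fi≡c , fj≡c = fibreCard-≥2⁻ (f ∘ suc) c 2≤ in
                 suc i , suc j , i≢j ∘ suc-injective , fi≡c , fj≡c

fibreCard-≤1⇒injective : ∀ {n m} (f : Fin n → Fin m) c → fibreCard f c ≤ 1 → ∀ {i j} → f i ≡ c → f j ≡ c → i ≡ j
fibreCard-≤1⇒injective f c ≤1 {i} {j} fi≡c fj≡c with i Fin.≟ j
... | yes i≡j = i≡j
... | no  i≢j = ⊥-elim (<⇒≱ (s≤s (s≤s z≤n)) (≤-trans (fibreCard-≥2 f i≢j fi≡c fj≡c) ≤1))

fibreCard-mono : ∀ {n m m'} (f : Fin n → Fin m) (f' : Fin n → Fin m') c c' → (∀ x → f x ≡ c → f' x ≡ c') →
                 fibreCard f c ≤ fibreCard f' c'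
fibreCard-mono f f' c c' f⊆f' = ∑-mono pointwise
  where
  pointwise : ∀ x → δ (f x) c 1 ≤ δ (f' x) c' 1
  pointwise x with f x Fin.≟ c
  ... | yes fx≡c = ≤-reflexive (sym (δ-≡ 1 (f⊆f' x fx≡c)))
  ... | no  _    = z≤n

length≡sum-map-1 : ∀ {A : Set} (xs : List A) → length xs ≡ sum (map (const 1) xs)
length≡sum-map-1 []       = refl
length≡sum-map-1 (_ ∷ xs) = cong suc (length≡sum-map-1 xs)

sum-map-filter-tabulate : ∀ {n m k} (w : Fin n → ℕ) (f : Fin n → Fin m) c (h : Fin k → Fin n) →
  sum (map w (filter (λ i → f i Fin.≟ c) (tabulate h))) ≡ fibreSum (w ∘ h) (f ∘ h) c
sum-map-filter-tabulate {k = zero}  w f c h = refl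
sum-map-filter-tabulate {k = suc k} w f c h with does (f (h zero) Fin.≟ c)
... | true  = cong (w (h zero) +_) (sum-map-filter-tabulate w f c (h ∘ suc))
... | false = sum-map-filter-tabulate w f c (h ∘ suc)

fibreSize≡fibreCard : ∀ {n} (f : SetPartition n) c → fibreSize f c ≡ fibreCard f c
fibreSize≡fibreCard f c =
  trans (length≡sum-map-1 (filter (λ i → f i Fin.≟ c) (allFin _))) (sum-map-filter-tabulate (const 1) f c id)

nonzero-accept : ∀ {x} xs → x ≢ 0 → nonzero (x ∷ xs) ≡ x ∷ nonzero xs
nonzero-accept xs = filter-accept (λ x → ¬? (x ≟ 0))

nonzero-reject : ∀ {x} xs → x ≡ 0 → nonzero (x ∷ xs) ≡ nonzero xs
nonzero-reject xs x≡0 = filter-reject (λ x → ¬? (x ≟ 0)) (λ x≢0 → x≢0 x≡0)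

nonzero-∷-cong : ∀ x {xs ys} → nonzero xs ≡ nonzero ys → nonzero (x ∷ xs) ≡ nonzero (x ∷ ys)
nonzero-∷-cong x {xs} {ys} eq with x ≟ 0
... | yes x≡0 = trans (nonzero-reject xs x≡0) (trans eq (sym (nonzero-reject ys x≡0)))
... | no  x≢0 = trans (nonzero-accept xs x≢0) (trans (cong (x ∷_) eq) (sym (nonzero-accept ys x≢0)))

nonzero-tabulate-zero : ∀ {n} (f : Fin n → ℕ) → (∀ i → f i ≡ 0) → nonzero (tabulate f) ≡ []
nonzero-tabulate-zero {zero}  f f≡0 = refl
nonzero-tabulate-zero {suc n} f f≡0 =
  trans (nonzero-reject (tabulate (f ∘ suc)) (f≡0 zero)) (nonzero-tabulate-zero (f ∘ suc) (f≡0 ∘ suc))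

nonzero-positive : ∀ {xs} → All (0 <_) xs → nonzero xs ≡ xs
nonzero-positive []                = refl
nonzero-positive {x ∷ xs} (x>0 ∷ xs>0) =
  trans (nonzero-accept xs (λ x≡0 → <-irrefl (sym x≡0) x>0)) (cong (x ∷_) (nonzero-positive xs>0))

∈-nonzero-tabulate⁻ : ∀ {n y} (f : Fin n → ℕ) → y ∈ nonzero (tabulate f) → ∃ λ d → f d ≡ y × y ≢ 0
∈-nonzero-tabulate⁻ f y∈ =
  let y∈f , y≢0 = ∈-filter⁻ (λ x → ¬? (x ≟ 0)) y∈
      d , y≡fd = ∈-tabulate⁻ y∈f
  in d , sym y≡fd , y≢0

∈-nonzero-tabulate⁺ : ∀ {n} (f : Fin n → ℕ) d → f d ≢ 0 → f d ∈ nonzero (tabulate f)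
∈-nonzero-tabulate⁺ f d = ∈-filter⁺ (λ x → ¬? (x ≟ 0)) (∈-tabulate⁺ d)

blockSizes-fibreCard : ∀ {n} (f : SetPartition n) → blockSizes f ≡ nonzero (tabulate (fibreCard f))
blockSizes-fibreCard f = cong nonzero (trans (map-tabulate id (fibreSize f)) (tabulate-cong (fibreSize≡fibreCard f)))

-- Block sizes and coarsenings

record GroupSums {N} (xs : List ℕ) (B : Fin N → ℕ) : Set where
  constructor grouping
  field
    labels : Fin (length xs) → Fin N
    sums   : fibreSum (at xs) labels ≗ B

groupSums-by : ∀ {N} xs (h : Fin (length xs) → Fin N) → GroupSums xs (fibreSum (at xs) h)
groupSums-by xs h = grouping h (λ _ → refl)

groupSums-≗ : ∀ {N xs} {B B' : Fin N → ℕ} → B ≗ B' → GroupSums xs B → GroupSums xs B'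
groupSums-≗ B≗B' (grouping g sums) = grouping g (λ d → trans (sums d) (B≗B' d))

groupSums-∷ : ∀ {N xs} {B : Fin N → ℕ} x l → GroupSums xs B → GroupSums (x ∷ xs) (λ d → δ l d x + B d)
groupSums-∷ x l (grouping g sums) = grouping (λ { zero → l ; (suc i) → g i }) (λ d → cong (δ l d x +_) (sums d))

groupSums-tabulate : ∀ {n N} (w : Fin n → ℕ) (h : Fin n → Fin N) → GroupSums (tabulate w) (fibreSum w h)
groupSums-tabulate {zero}  w h = grouping (λ ()) (λ _ → refl)
groupSums-tabulate {suc n} w h = groupSums-∷ (w zero) (h zero) (groupSums-tabulate (w ∘ suc) (h ∘ suc))

groupSums-nonzero : ∀ {N} xs {B : Fin N → ℕ} → GroupSums xs B → GroupSums (nonzero xs) B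
groupSums-nonzero []       G = G
groupSums-nonzero (x ∷ xs) (grouping h sums) with x ≟ 0
... | yes x≡0 rewrite nonzero-reject xs x≡0 =
  groupSums-≗ (λ d → trans (cong (_+ fibreSum (at xs) (h ∘ suc) d) (sym (trans (cong (δ (h zero) d) x≡0) (δ-zero (h zero) d))))
                           (sums d))
              (groupSums-nonzero xs (groupSums-by xs (h ∘ suc)))
... | no  x≢0 rewrite nonzero-accept xs x≢0 =
  groupSums-≗ sums (groupSums-∷ x (h zero) (groupSums-nonzero xs (groupSums-by xs (h ∘ suc))))

groupSums-↭ : ∀ {N xs ys} {B : Fin N → ℕ} → xs ↭ ys → GroupSums xs B → GroupSums ys B
groupSums-↭ ↭.refl                     G                 = G
groupSums-↭ (↭.prep x xs↭ys)           (grouping h sums) =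
  groupSums-≗ sums (groupSums-∷ x (h zero) (groupSums-↭ xs↭ys (groupSums-by _ (h ∘ suc))))
groupSums-↭ (↭.swap {xs} x y xs↭ys)    (grouping h sums) =
  groupSums-≗ (λ d → trans (x∙yz≈y∙xz (δ (h (suc zero)) d y) (δ (h zero) d x) _) (sums d))
              (groupSums-∷ y (h (suc zero)) (groupSums-∷ x (h zero)
                (groupSums-↭ xs↭ys (groupSums-by xs (λ i → h (suc (suc i)))))))
groupSums-↭ (↭.trans xs↭ys ys↭zs)      G                 = groupSums-↭ ys↭zs (groupSums-↭ xs↭ys G)

nonzero-tabulate-inject≤ : ∀ {N r} (N≤r : N ≤ r) (B : Fin r → ℕ) →
                           (∀ c → (∀ d → inject≤ d N≤r ≢ c) → B c ≡ 0) →
                           nonzero (tabulate B) ≡ nonzero (tabulate (λ d → B (inject≤ d N≤r)))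
nonzero-tabulate-inject≤ {zero}  N≤r       B B≡0 = nonzero-tabulate-zero B (λ c → B≡0 c (λ ()))
nonzero-tabulate-inject≤ {suc N} (s≤s N≤r) B B≡0 =
  nonzero-∷-cong (B zero) (nonzero-tabulate-inject≤ N≤r (B ∘ suc)
    (λ c c∉ → B≡0 (suc c) λ { zero () ; (suc d) eq → c∉ d (suc-injective eq) }))

nonzero-tabulate-punchIn : ∀ {N} (d : Fin (suc N)) (B : Fin (suc N) → ℕ) → B d ≡ 0 →
                           nonzero (tabulate B) ≡ nonzero (tabulate (λ e → B (punchIn d e)))
nonzero-tabulate-punchIn zero              B Bd≡0 = nonzero-reject (tabulate (B ∘ suc)) Bd≡0
nonzero-tabulate-punchIn {suc N} (suc d) B Bd≡0 = nonzero-∷-cong (B zero) (nonzero-tabulate-punchIn d (B ∘ suc) Bd≡0)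

unusedLabel : ∀ {r N} → r < N → (g : Fin r → Fin N) → ∃ λ d → ∀ i → g i ≢ d
unusedLabel {r} {N} r<N g with any? (λ d → all? (λ i → ¬? (g i Fin.≟ d)))
... | yes unused = unused
... | no  allUsed = ⊥-elim (section-not-injective (pigeonhole r<N section))
  where
  preimage : ∀ d → ∃ λ i → g i ≡ d
  preimage d with any? (λ i → g i Fin.≟ d)
  ... | yes found    = found
  ... | no  notFound = ⊥-elim (allUsed (d , λ i gi≡d → notFound (i , gi≡d)))
  section : Fin N → Fin r
  section = proj₁ ∘ preimage
  section-not-injective : ¬ (∃₂ λ d e → d Fin.< e × section d ≡ section e)
  section-not-injective (d , e , d<e , same) =
    <-irrefl (cong toℕ (trans (sym (proj₂ (preimage d))) (trans (cong g same) (proj₂ (preimage e))))) d<e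

fibreSums-relabel : ∀ {r} N (w : Fin r → ℕ) (g' : Fin r → Fin N) →
                    ∃ λ (g : Fin r → Fin r) → nonzero (tabulate (fibreSum w g')) ≡ nonzero (tabulate (fibreSum w g))
fibreSums-relabel {r} N w g' with N ≤? r
... | yes N≤r = (λ i → ι (g' i)) , sym (trans
        (nonzero-tabulate-inject≤ N≤r (fibreSum w (ι ∘ g')) (λ c c∉ι → fibreSum-outsideImage w (ι ∘ g') c (c∉ι ∘ g')))
        (cong nonzero (tabulate-cong (fibreSum-injective w g' ι (inject≤-injective N≤r N≤r _ _)))))
  where
  ι : Fin N → Fin r
  ι d = inject≤ d N≤r
fibreSums-relabel zero    w g' | no N≰r = ⊥-elim (N≰r z≤n)
fibreSums-relabel (suc N) w g' | no N≰r with unusedLabel (≰⇒> N≰r) g'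
... | d , d∉g' =
  let g , eq = fibreSums-relabel N w g'' in
  g , trans (nonzero-tabulate-punchIn d (fibreSum w g') (fibreSum-outsideImage w g' d d∉g'))
     (trans (cong nonzero (tabulate-cong λ e →
               trans (fibreSum-cong (λ _ → refl) (λ i → sym (punchIn-punchOut (d≢g' i))) (punchIn d e))
                     (fibreSum-injective w g'' (punchIn d) (punchIn-injective d _ _) e)))
            eq)
  where
  d≢g' : ∀ i → d ≢ g' i
  d≢g' i = d∉g' i ∘ sym
  g'' : Fin _ → Fin N
  g'' i = punchOut (d≢g' i)

coarseSums≡ : ∀ L (g : Fin (length L) → Fin (length L)) →
  nonzero (map (λ c → sum (map (at L) (filter (λ i → g i Fin.≟ c) (allFin (length L))))) (allFin (length L)))
    ≡ nonzero (tabulate (fibreSum (at L) g))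
coarseSums≡ L g = cong nonzero (trans (map-tabulate id _) (tabulate-cong (λ c → sum-map-filter-tabulate (at L) g c id)))

coarser-intro : ∀ {N μ L} {B : Fin N → ℕ} → Linked _≥_ μ → GroupSums L B → μ ↭ nonzero (tabulate B) → Coarser μ L
coarser-intro {N} {μ} {L} {B} μ-sorted (grouping g' g'-sums) μ↭B =
  let g , eq = fibreSums-relabel N (at L) g' in
  g , μ-sorted , ↭-trans μ↭B (↭-reflexive (trans (cong nonzero (sym (tabulate-cong g'-sums))) (trans eq (sym (coarseSums≡ L g)))))

-- The smallest part different from 1

n≢0⇒n≢1⇒2≤n : ∀ {n} → n ≢ 0 → n ≢ 1 → 2 ≤ n
n≢0⇒n≢1⇒2≤n {0}           n≢0 _   = ⊥-elim (n≢0 refl)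
n≢0⇒n≢1⇒2≤n {1}           _   n≢1 = ⊥-elim (n≢1 refl)
n≢0⇒n≢1⇒2≤n {suc (suc n)} _   _   = s≤s (s≤s z≤n)

2≤n⇒n≢1 : ∀ {n} → 2 ≤ n → n ≢ 1
2≤n⇒n≢1 (s≤s ()) refl

2≤n⇒n≢0 : ∀ {n} → 2 ≤ n → n ≢ 0
2≤n⇒n≢0 () refl

smallestNon1-allOnes : ∀ {xs} → All (_≡ 1) xs → smallestNon1 xs ≡ 0
smallestNon1-allOnes [] = refl
smallestNon1-allOnes {x ∷ xs} (x≡1 ∷ xs≡1) with x ≟ 1
... | yes _   = smallestNon1-allOnes xs≡1
... | no  x≢1 = ⊥-elim (x≢1 x≡1)

smallestNon1-∈ : ∀ {xs} → All (0 <_) xs → Any (_≢ 1) xs → smallestNon1 xs ∈ xs × smallestNon1 xs ≢ 1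
smallestNon1-∈ {x ∷ xs} (_ ∷ xs>0) non1 with x ≟ 1
smallestNon1-∈ {x ∷ xs} (_ ∷ xs>0) (here x≢1)   | yes x≡1 = ⊥-elim (x≢1 x≡1)
smallestNon1-∈ {x ∷ xs} (_ ∷ xs>0) (there non1) | yes _   = let s∈ , s≢1 = smallestNon1-∈ xs>0 non1 in there s∈ , s≢1
... | no x≢1 with smallestNon1 xs in eq
...   | zero  = here refl , x≢1
...   | suc s with All.all? (_≟ 1) xs
...     | yes xs≡1  = ⊥-elim (0≢1+n (trans (sym (smallestNon1-allOnes xs≡1)) eq))
...     | no  xs≢1 with smallestNon1-∈ xs>0 (¬All⇒Any¬ (_≟ 1) xs xs≢1) | ⊓-sel x (suc s)
...       | _       , _   | inj₁ min≡x rewrite min≡x = here refl , x≢1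
...       | s∈ , s≢1 | inj₂ min≡s rewrite min≡s | eq = there s∈ , s≢1

smallestNon1-≤ : ∀ {xs y} → All (0 <_) xs → y ∈ xs → y ≢ 1 → smallestNon1 xs ≤ y
smallestNon1-≤ {x ∷ xs} (_ ∷ xs>0) y∈ y≢1 with x ≟ 1
smallestNon1-≤ {x ∷ xs} (_ ∷ xs>0) (here refl) y≢1 | yes x≡1 = ⊥-elim (y≢1 x≡1)
smallestNon1-≤ {x ∷ xs} (_ ∷ xs>0) (there y∈)  y≢1 | yes _   = smallestNon1-≤ xs>0 y∈ y≢1
... | no x≢1 with smallestNon1 xs in eq
smallestNon1-≤ (_ ∷ xs>0) (here refl) y≢1 | no _ | zero = ≤-refl
smallestNon1-≤ (_ ∷ xs>0) (there y∈)  y≢1 | no _ | zero =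
  let s∈ , _ = smallestNon1-∈ xs>0 (Any.map (λ y≡z z≡1 → y≢1 (trans y≡z z≡1)) y∈)
  in ⊥-elim (<-irrefl (sym eq) (All.lookup xs>0 s∈))
smallestNon1-≤ {x ∷ xs} (_ ∷ xs>0) (here refl) y≢1 | no _ | suc s = m⊓n≤m x (suc s)
smallestNon1-≤ {x ∷ xs} (_ ∷ xs>0) (there y∈)  y≢1 | no _ | suc s =
  ≤-trans (m⊓n≤n x (suc s)) (subst (_≤ _) eq (smallestNon1-≤ xs>0 y∈ y≢1))

allOnes≡ones : ∀ {xs} → All (_≡ 1) xs → xs ≡ ones (sum xs)
allOnes≡ones []            = refl
allOnes≡ones (refl ∷ xs≡1) = cong (1 ∷_) (allOnes≡ones xs≡1)

≢ones⇒non1 : ∀ {k xs} → IsPartition k xs → xs ≢ ones k → Any (_≢ 1) xs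
≢ones⇒non1 {k} {xs} (_ , _ , sum≡k) xs≢ones with All.all? (_≟ 1) xs
... | yes xs≡1 = ⊥-elim (xs≢ones (trans (allOnes≡ones xs≡1) (cong ones sum≡k)))
... | no  xs≢1 = ¬All⇒Any¬ (_≟ 1) xs xs≢1

smallestNon1-partition : ∀ {k ν} → IsPartition k ν → ν ≢ ones k → smallestNon1 ν ∈ ν × 2 ≤ smallestNon1 ν
smallestNon1-partition ν-part@(_ , ν>0 , _) ν≢ones =
  let ς∈ , ς≢1 = smallestNon1-∈ ν>0 (≢ones⇒non1 ν-part ν≢ones)
  in ς∈ , n≢0⇒n≢1⇒2≤n (λ ς≡0 → <-irrefl (sym ς≡0) (All.lookup ν>0 ς∈)) ς≢1

fibreCard∈type : ∀ {n L} {f : SetPartition n} → HasType f L → ∀ c → fibreCard f c ≢ 0 → fibreCard f c ∈ L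
fibreCard∈type {f = f} (_ , L↭) c ≢0 =
  ∈-resp-↭ (↭-sym L↭) (subst (fibreCard f c ∈_) (sym (blockSizes-fibreCard f)) (∈-nonzero-tabulate⁺ (fibreCard f) c ≢0))

type∈⇒fibreCard : ∀ {n L y} {f : SetPartition n} → HasType f L → y ∈ L → ∃ λ c → fibreCard f c ≡ y
type∈⇒fibreCard {f = f} (_ , L↭) y∈ =
  let c , eq , _ = ∈-nonzero-tabulate⁻ (fibreCard f) (subst (_ ∈_) (blockSizes-fibreCard f) (∈-resp-↭ L↭ y∈))
  in c , eq

-- Necessity

refines⇒factors : ∀ {n} {π σ : SetPartition n} → Refines π σ → ∃ λ (h : Fin n → Fin n) → σ ≗ h ∘ π
refines⇒factors {π = π} {σ} π⊑σ = σ ∘ representative , σ≡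
  where
  representative : Fin _ → Fin _
  representative y with any? (λ x → π x Fin.≟ y)
  ... | yes (x , _) = x
  ... | no  _       = y
  σ≡ : ∀ x → σ x ≡ σ (representative (π x))
  σ≡ x with any? (λ z → π z Fin.≟ π x)
  ... | yes (z , πz≡πx) = π⊑σ x z (sym πz≡πx)
  ... | no  none        = ⊥-elim (none (x , refl))

refines⇒coarser : ∀ {n μ λ'} {π σ : SetPartition n} → Refines π σ → HasType π λ' → HasType σ μ → Coarser μ λ'
refines⇒coarser {μ = μ} {λ'} {π} {σ} π⊑σ (_ , λ'↭) (μ-sorted , μ↭) = coarser-intro μ-sorted λ'-sums μ↭sums
  where
  h = proj₁ (refines⇒factors π⊑σ)
  σ-sizes : fibreCard σ ≗ fibreSum (fibreCard π) h
  σ-sizes d = trans (fibreSum-cong (λ _ → refl) (proj₂ (refines⇒factors π⊑σ)) d) (fibreSum-∘ (const 1) π h d)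
  λ'-sums : GroupSums λ' (fibreSum (fibreCard π) h)
  λ'-sums = groupSums-↭ (↭-sym (subst (λ' ↭_) (blockSizes-fibreCard π) λ'↭))
              (groupSums-nonzero (tabulate (fibreCard π)) (groupSums-tabulate (fibreCard π) h))
  μ↭sums : μ ↭ nonzero (tabulate (fibreSum (fibreCard π) h))
  μ↭sums = ↭-trans μ↭ (↭-reflexive (trans (blockSizes-fibreCard σ) (cong nonzero (tabulate-cong σ-sizes))))

-- If no πₐ identifies two points of the σ-block of i, splitting that block into singletons
-- gives an upper bound of the πₐ which does not identify i and j.
join-mergesPair : ∀ {n m} {πs : Fin m → SetPartition n} {σ : SetPartition n} → IsJoin πs σ →
                  ∀ {i j} → i ≢ j → σ i ≡ σ j → ∃ λ a → ∃₂ λ x y → x ≢ y × σ x ≡ σ i × πs a x ≡ πs a y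
join-mergesPair {πs = πs} {σ} (πs⊑σ , σ-least) {i} {j} i≢j σi≡σj
  with any? (λ a → any? (λ x → any? (λ y → ¬? (x Fin.≟ y) ×-dec (σ x Fin.≟ σ i) ×-dec (πs a x Fin.≟ πs a y))))
... | yes pair = pair
... | no  none = ⊥-elim (i≢j (trans (sym (split-inside i refl)) (trans split-i≡split-j (split-inside j (sym σi≡σj)))))
  where
  split : SetPartition _
  split x with σ x Fin.≟ σ i
  ... | yes _ = x
  ... | no  _ = σ x
  split-inside : ∀ x → σ x ≡ σ i → split x ≡ x
  split-inside x σx≡σi with σ x Fin.≟ σ i
  ... | yes _     = refl
  ... | no  σx≢σi = ⊥-elim (σx≢σi σx≡σi)
  split-outside : ∀ x → σ x ≢ σ i → split x ≡ σ x
  split-outside x σx≢σi with σ x Fin.≟ σ i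
  ... | yes σx≡σi = ⊥-elim (σx≢σi σx≡σi)
  ... | no  _     = refl
  πs⊑split : ∀ a → Refines (πs a) split
  πs⊑split a x y πx≡πy with x Fin.≟ y
  ... | yes x≡y = cong split x≡y
  ... | no  x≢y = byBlock (σ x Fin.≟ σ i)
    where
    byBlock : Dec (σ x ≡ σ i) → split x ≡ split y
    byBlock (yes σx≡σi) = ⊥-elim (none (a , x , y , x≢y , σx≡σi , πx≡πy))
    byBlock (no  σx≢σi) = trans (split-outside x σx≢σi)
      (trans (πs⊑σ a x y πx≡πy) (sym (split-outside y (σx≢σi ∘ trans (πs⊑σ a x y πx≡πy)))))
  split-i≡split-j : split i ≡ split j
  split-i≡split-j = σ-least split πs⊑split i j σi≡σj

join-nontrivialBlock : ∀ {n m} {πs : Fin m → SetPartition n} {σ : SetPartition n} → IsJoin πs σ →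
  ∀ d → 2 ≤ fibreCard σ d → ∃₂ λ a c → 2 ≤ fibreCard (πs a) c × fibreCard (πs a) c ≤ fibreCard σ d
join-nontrivialBlock {πs = πs} {σ} join@(πs⊑σ , _) d 2≤card =
  let i , j , i≢j , σi≡d , σj≡d = fibreCard-≥2⁻ σ d 2≤card
      a , x , y , x≢y , σx≡σi , πx≡πy = join-mergesPair join i≢j (trans σi≡d (sym σj≡d))
  in a , πs a x , fibreCard-≥2 (πs a) x≢y refl (sym πx≡πy) ,
     fibreCard-mono (πs a) σ _ d (λ z πz≡πx → trans (πs⊑σ a z x πz≡πx) (trans σx≡σi σi≡d))

join⇒smallestNon1-≤ : ∀ {k m μ λ'} {πs : Fin m → SetPartition k} {σ : SetPartition k} →
  IsPartition k μ → μ ≢ ones k → All (0 <_) λ' → (∀ a → HasType (πs a) λ') → IsJoin πs σ → HasType σ μ →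
  smallestNon1 λ' ≤ smallestNon1 μ
join⇒smallestNon1-≤ {μ = μ} {λ'} {πs} {σ} μ-part μ≢ones λ'>0 πs-types join σ-type =
  let ς∈μ , 2≤ς = smallestNon1-partition μ-part μ≢ones
      d , card≡ς = type∈⇒fibreCard {f = σ} σ-type ς∈μ
      a , c , 2≤card , card≤ = join-nontrivialBlock join d (subst (2 ≤_) (sym card≡ς) 2≤ς)
      card∈λ' = fibreCard∈type (πs-types a) c (2≤n⇒n≢0 2≤card)
  in ≤-trans (smallestNon1-≤ λ'>0 card∈λ' (2≤n⇒n≢1 2≤card)) (≤-trans card≤ (≤-reflexive card≡ς))

-- Sufficiency

segment : (ps : List ℕ) → Fin (sum ps) → Fin (length ps)
segment (p ∷ ps) x = [ const zero , suc ∘ segment ps ]′ (splitAt p x)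

fibreCard-segment : ∀ ps t → fibreCard (segment ps) t ≡ at ps t
fibreCard-segment (p ∷ ps) t = trans split (byPart t)
  where
  split : fibreCard (segment (p ∷ ps)) t ≡ fibreCard {p} (const zero) t + fibreCard (suc ∘ segment ps) t
  split = trans (∑-splitAt p (sum ps) _) (cong₂ _+_
    (sum-cong-≗ λ i → cong (λ s → δ ([ const zero , suc ∘ segment ps ]′ s) t 1) (splitAt-↑ˡ p i (sum ps)))
    (sum-cong-≗ λ j → cong (λ s → δ ([ const zero , suc ∘ segment ps ]′ s) t 1) (splitAt-↑ʳ p (sum ps) j)))
  byPart : ∀ t → fibreCard {p} (const zero) t + fibreCard (suc ∘ segment ps) t ≡ at (p ∷ ps) t
  byPart zero    = trans (cong₂ _+_ (∑-const p 1) (fibreSum-outsideImage (const 1) (suc ∘ segment ps) zero (λ _ ())))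
                         (trans (+-identityʳ _) (*-identityʳ p))
  byPart (suc t) = trans (cong (_+ fibreCard (suc ∘ segment ps) (suc t))
                               (fibreSum-outsideImage {p} (const 1) (const zero) (suc t) (λ _ ())))
                         (fibreCard-segment ps t)

length≤sum : ∀ {ps} → All (0 <_) ps → length ps ≤ sum ps
length≤sum []         = z≤n
length≤sum (p>0 ∷ ps>0) = +-mono-≤ p>0 (length≤sum ps>0)

blockSizes-inject≤ : ∀ {r n} (r≤n : r ≤ n) (φ : Fin n → Fin r) →
                     blockSizes (λ x → inject≤ (φ x) r≤n) ≡ nonzero (tabulate (fibreCard φ))
blockSizes-inject≤ r≤n φ = trans (blockSizes-fibreCard (ι ∘ φ)) (trans
  (nonzero-tabulate-inject≤ r≤n (fibreCard (ι ∘ φ)) (λ c c∉ι → fibreSum-outsideImage (const 1) (ι ∘ φ) c (c∉ι ∘ φ)))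
  (cong nonzero (tabulate-cong (fibreSum-injective (const 1) φ ι (inject≤-injective r≤n r≤n _ _)))))
  where
  ι = λ d → inject≤ d r≤n

fibreCard-∘perm : ∀ {n m} (f : Fin n → Fin m) (ρ : Permutation n n) c → fibreCard (f ∘ (ρ ⟨$⟩ʳ_)) c ≡ fibreCard f c
fibreCard-∘perm f ρ c = sym (sum-permute (λ x → δ (f x) c 1) ρ)

HasType-∘perm : ∀ {n L} {f : SetPartition n} (ρ : Permutation n n) → HasType f L → HasType (f ∘ (ρ ⟨$⟩ʳ_)) L
HasType-∘perm {f = f} ρ (L-sorted , L↭) = L-sorted , subst (_ ↭_) sizes≡ L↭
  where
  sizes≡ : blockSizes f ≡ blockSizes (f ∘ (ρ ⟨$⟩ʳ_))
  sizes≡ = trans (blockSizes-fibreCard f) (sym (trans (blockSizes-fibreCard (f ∘ (ρ ⟨$⟩ʳ_)))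
             (cong nonzero (tabulate-cong (fibreCard-∘perm f ρ)))))

Refines-∘ : ∀ {n} {π σ : SetPartition n} (ρ : Fin n → Fin n) → Refines π σ → σ ∘ ρ ≗ σ → Refines (π ∘ ρ) σ
Refines-∘ ρ π⊑σ σρ≗σ x y πρx≡πρy = trans (sym (σρ≗σ x)) (trans (π⊑σ (ρ x) (ρ y) πρx≡πρy) (σρ≗σ y))

transpose-at : ∀ {n} (i j : Fin n) → PC.transpose i j i ≡ j
transpose-at i j rewrite dec-true (i Fin.≟ i) refl = refl

transpose-fix : ∀ {n} {i j x : Fin n} → x ≢ i → x ≢ j → PC.transpose i j x ≡ x
transpose-fix {i = i} {j} {x} x≢i x≢j rewrite dec-false (x Fin.≟ i) x≢i | dec-false (x Fin.≟ j) x≢j = refl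

transpose-preserves : ∀ {n m} (σ : Fin n → Fin m) {i j} → σ i ≡ σ j → σ ∘ PC.transpose i j ≗ σ
transpose-preserves σ {i} {j} σi≡σj x with x Fin.≟ i
... | yes refl = sym σi≡σj
... | no  _ with x Fin.≟ j
...   | yes refl = σi≡σj
...   | no  _    = refl

-- Conjugating by two transpositions that preserve σ moves the identified pair a, b onto i, j.
relocateMergedPair : ∀ {n L} {π σ : SetPartition n} → HasType π L → Refines π σ →
  ∀ {a b i j} → a ≢ b → π a ≡ π b → σ a ≡ σ i → σ i ≡ σ j → i ≢ j →
  Σ (SetPartition n) λ π' → HasType π' L × Refines π' σ × π' i ≡ π' j
relocateMergedPair {π = π} {σ} π-type π⊑σ {a} {b} {i} {j} a≢b πa≡πb σa≡σi σi≡σj i≢j =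
  π ∘ t₁ ∘ t₂ ,
  HasType-∘perm (transpose j b') (HasType-∘perm (transpose i a) π-type) ,
  Refines-∘ t₂ (Refines-∘ t₁ π⊑σ (transpose-preserves σ (sym σa≡σi))) (transpose-preserves σ σj≡σb') ,
  (begin
    π (t₁ (t₂ i)) ≡⟨ cong (π ∘ t₁) (transpose-fix i≢j (b'≢i ∘ sym)) ⟩
    π (t₁ i)      ≡⟨ cong π (transpose-at i a) ⟩
    π a           ≡⟨ πa≡πb ⟩
    π b           ≡⟨ cong π (sym (PC.transpose-inverse i a)) ⟩
    π (t₁ b')     ≡⟨ cong (π ∘ t₁) (sym (transpose-at j b')) ⟩
    π (t₁ (t₂ j)) ∎)
  where
  open ≡-Reasoning
  t₁ = PC.transpose i a
  b' = PC.transpose a i b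
  t₂ = PC.transpose j b'
  b'≢i : b' ≢ i
  b'≢i b'≡i = a≢b (trans (sym (transpose-at i a)) (trans (cong t₁ (sym b'≡i)) (PC.transpose-inverse i a)))
  σj≡σb' : σ j ≡ σ b'
  σj≡σb' = trans (sym σi≡σj) (trans (sym σa≡σi) (trans (π⊑σ a b πa≡πb) (sym (transpose-preserves σ σa≡σi b))))

record Enumeration {n} (P : Fin n → Set) (size : ℕ) : Set where
  field
    elem      : Fin size → Fin n
    injective : ∀ {l l'} → elem l ≡ elem l' → l ≡ l'
    valid     : ∀ l → P (elem l)
    complete  : ∀ x → P x → ∃ λ l → elem l ≡ x

enumerateFibre : ∀ {n m} (f : Fin n → Fin m) c → Enumeration (λ x → f x ≡ c) (fibreCard f c)
enumerateFibre {zero}  f c = record { elem = λ () ; injective = λ { {()} } ; valid = λ () ; complete = λ () }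
enumerateFibre {suc n} f c with enumerateFibre (f ∘ suc) c | f zero Fin.≟ c
... | E | yes f0≡c = record
  { elem      = λ { zero → zero ; (suc l) → suc (elem l) }
  ; injective = λ { {zero} {zero} _ → refl ; {suc l} {suc l'} eq → cong suc (injective (suc-injective eq)) }
  ; valid     = λ { zero → f0≡c ; (suc l) → valid l }
  ; complete  = λ { zero _ → zero , refl ; (suc x) fx≡c → let l , eq = complete x fx≡c in suc l , cong suc eq }
  }
  where open Enumeration E
... | E | no f0≢c = record
  { elem      = suc ∘ elem
  ; injective = injective ∘ suc-injective
  ; valid     = valid
  ; complete  = λ { zero f0≡c → ⊥-elim (f0≢c f0≡c) ; (suc x) fx≡c → let l , eq = complete x fx≡c in l , cong suc eq }
  }
  where open Enumeration E

module Exchange {n s} (e₁ e₂ : Fin s → Fin n)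
                (e₁-injective : ∀ {l l'} → e₁ l ≡ e₁ l' → l ≡ l')
                (e₂-injective : ∀ {l l'} → e₂ l ≡ e₂ l' → l ≡ l')
                (disjoint : ∀ l l' → e₁ l ≢ e₂ l') where

  data Position (x : Fin n) : Set where
    first   : ∀ l → e₁ l ≡ x → Position x
    second  : ∀ l → e₂ l ≡ x → Position x
    neither : (∀ l → e₁ l ≢ x) → (∀ l → e₂ l ≢ x) → Position x

  position : ∀ x → Position x
  position x with any? (λ l → e₁ l Fin.≟ x) | any? (λ l → e₂ l Fin.≟ x)
  ... | yes (l , e₁l≡x) | _               = first l e₁l≡x
  ... | no  _           | yes (l , e₂l≡x) = second l e₂l≡x
  ... | no  ∉e₁         | no  ∉e₂         = neither (λ l eq → ∉e₁ (l , eq)) (λ l eq → ∉e₂ (l , eq))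

  exchange : Fin n → Fin n
  exchange x with position x
  ... | first   l _ = e₂ l
  ... | second  l _ = e₁ l
  ... | neither _ _ = x

  exchange-first : ∀ l → exchange (e₁ l) ≡ e₂ l
  exchange-first l with position (e₁ l)
  ... | first   l' eq  = cong e₂ (e₁-injective eq)
  ... | second  l' eq  = ⊥-elim (disjoint l l' (sym eq))
  ... | neither ∉e₁ _  = ⊥-elim (∉e₁ l refl)

  exchange-second : ∀ l → exchange (e₂ l) ≡ e₁ l
  exchange-second l with position (e₂ l)
  ... | first   l' eq  = ⊥-elim (disjoint l' l eq)
  ... | second  l' eq  = cong e₁ (e₂-injective eq)
  ... | neither _ ∉e₂  = ⊥-elim (∉e₂ l refl)

  exchange-neither : ∀ {x} → (∀ l → e₁ l ≢ x) → (∀ l → e₂ l ≢ x) → exchange x ≡ x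
  exchange-neither {x} ∉e₁ ∉e₂ with position x
  ... | first   l eq = ⊥-elim (∉e₁ l eq)
  ... | second  l eq = ⊥-elim (∉e₂ l eq)
  ... | neither _ _  = refl

  exchange-involutive : ∀ x → exchange (exchange x) ≡ x
  exchange-involutive x = byPosition (position x)
    where
    byPosition : Position x → exchange (exchange x) ≡ x
    byPosition (first   l refl) = trans (cong exchange (exchange-first l)) (exchange-second l)
    byPosition (second  l refl) = trans (cong exchange (exchange-second l)) (exchange-first l)
    byPosition (neither ∉e₁ ∉e₂) = trans (cong exchange (exchange-neither ∉e₁ ∉e₂)) (exchange-neither ∉e₁ ∉e₂)

  exchangePermutation : Permutation n n
  exchangePermutation = permutation exchange exchange exchange-involutive exchange-involutive

isJoin-intro : ∀ {n m} {πs : Fin m → SetPartition n} {σ : SetPartition n} → (∀ a → Refines (πs a) σ) →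
               (∀ i j → σ i ≡ σ j → ∃ λ a → πs a i ≡ πs a j) → IsJoin πs σ
isJoin-intro πs⊑σ merges =
  πs⊑σ , λ τ πs⊑τ i j σi≡σj → let a , πi≡πj = merges i j σi≡σj in πs⊑τ a i j πi≡πj

pairwiseFamily : ∀ {n} {σ : SetPartition n} (P : SetPartition n → Set) {π₀ : SetPartition n} → P π₀ →
  (∀ i j → Σ (SetPartition n) λ π → P π × (σ i ≡ σ j → π i ≡ π j)) →
  Σ (Fin (suc (n * n)) → SetPartition n) λ πs →
    (∀ a → P (πs a)) × (∀ i j → σ i ≡ σ j → ∃ λ a → πs a i ≡ πs a j)
pairwiseFamily {n} {σ} P {π₀} Pπ₀ forPair = family , familyP , merges
  where
  forPair′ : ((i , j) : Fin n × Fin n) → Σ (SetPartition n) λ π → P π × (σ i ≡ σ j → π i ≡ π j)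
  forPair′ (i , j) = forPair i j
  family : Fin (suc (n * n)) → SetPartition n
  family zero    = π₀
  family (suc z) = proj₁ (forPair′ (remQuot n z))
  familyP : ∀ a → P (family a)
  familyP zero    = Pπ₀
  familyP (suc z) = proj₁ (proj₂ (forPair′ (remQuot n z)))
  merges : ∀ i j → σ i ≡ σ j → ∃ λ a → family a i ≡ family a j
  merges i j σi≡σj = suc (combine i j) ,
    subst (λ p → proj₁ (forPair′ p) i ≡ proj₁ (forPair′ p) j) (sym (remQuot-combine i j))
          (proj₂ (proj₂ (forPair i j)) σi≡σj)

twoDistinct : ∀ {s} → 2 ≤ s → ∃₂ λ (l l' : Fin s) → l ≢ l'
twoDistinct (s≤s (s≤s _)) = zero , suc zero , λ ()

module Layout (L : List ℕ) (L-sorted : Linked _≥_ L) (L>0 : All (0 <_) L) (g : Fin (length L) → Fin (length L)) where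

  r≤k : length L ≤ sum L
  r≤k = length≤sum L>0

  ι : Fin (length L) → Fin (sum L)
  ι t = inject≤ t r≤k

  ι-injective : ∀ {t t'} → ι t ≡ ι t' → t ≡ t'
  ι-injective = inject≤-injective r≤k r≤k _ _

  π₀ σ : SetPartition (sum L)
  π₀ = ι ∘ segment L
  σ  = ι ∘ g ∘ segment L

  π₀-card : ∀ t → fibreCard π₀ (ι t) ≡ at L t
  π₀-card t = trans (fibreSum-injective (const 1) (segment L) ι ι-injective t) (fibreCard-segment L t)

  π₀-type : HasType π₀ L
  π₀-type = L-sorted , ↭-reflexive (sym (begin
    blockSizes π₀                              ≡⟨ blockSizes-inject≤ r≤k (segment L) ⟩
    nonzero (tabulate (fibreCard (segment L))) ≡⟨ cong nonzero (tabulate-cong (fibreCard-segment L)) ⟩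
    nonzero (tabulate (at L))                  ≡⟨ cong nonzero (tabulate-lookup L) ⟩
    nonzero L                                  ≡⟨ nonzero-positive L>0 ⟩
    L                                          ∎))
    where open ≡-Reasoning

  σ-sizes : blockSizes σ ≡ nonzero (tabulate (fibreSum (at L) g))
  σ-sizes = trans (blockSizes-inject≤ r≤k (g ∘ segment L)) (cong nonzero (tabulate-cong λ c →
    trans (fibreSum-∘ (const 1) (segment L) g c) (fibreSum-cong {f = g} (fibreCard-segment L) (λ _ → refl) c)))

  π₀⊑σ : Refines π₀ σ
  π₀⊑σ x y π₀x≡π₀y = cong (ι ∘ g) (ι-injective π₀x≡π₀y)

  -- Every π₀-block inside the σ-block c is a singleton. Exchanging the π₀-block u with
  -- |u| points of c keeps the type and still refines σ, and now c contains a block of size |u|.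
  module Swap (c u : Fin (length L)) (u∉c : g u ≢ c) (c-singletons : ∀ t → g t ≡ c → at L t ≤ 1)
              (u-fits : fibreCard π₀ (ι u) ≤ fibreCard σ (ι c)) where

    module S = Enumeration (enumerateFibre π₀ (ι u))
    module B = Enumeration (enumerateFibre σ (ι c))

    e₂ : Fin (fibreCard π₀ (ι u)) → Fin (sum L)
    e₂ l = B.elem (inject≤ l u-fits)

    e₂-injective : ∀ {l l'} → e₂ l ≡ e₂ l' → l ≡ l'
    e₂-injective = inject≤-injective u-fits u-fits _ _ ∘ B.injective

    e₂-in-c : ∀ l → σ (e₂ l) ≡ ι c
    e₂-in-c l = B.valid (inject≤ l u-fits)

    disjoint : ∀ l l' → S.elem l ≢ e₂ l'
    disjoint l l' eq =
      u∉c (ι-injective (trans (sym (cong (ι ∘ g) (ι-injective (S.valid l)))) (trans (cong σ eq) (e₂-in-c l'))))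

    open Exchange S.elem e₂ S.injective e₂-injective disjoint

    π' : SetPartition (sum L)
    π' = π₀ ∘ exchange

    π'-type : HasType π' L
    π'-type = HasType-∘perm exchangePermutation π₀-type

    c-singleton : ∀ {z w} → σ z ≡ ι c → π₀ w ≡ π₀ z → w ≡ z
    c-singleton {z} σz≡ιc π₀w≡π₀z =
      fibreCard-≤1⇒injective π₀ (π₀ z) z-singleton π₀w≡π₀z refl
      where
      z-singleton : fibreCard π₀ (π₀ z) ≤ 1
      z-singleton = subst (_≤ 1) (sym (π₀-card (segment L z))) (c-singletons (segment L z) (ι-injective σz≡ιc))

    fromFirst : ∀ l y → π' (S.elem l) ≡ π' y → S.elem l ≡ y
    fromFirst l y π'≡ = begin
      S.elem l                ≡⟨ sym (exchange-second l) ⟩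
      exchange (e₂ l)         ≡⟨ cong exchange (sym (c-singleton (e₂-in-c l)
                                   (trans (sym π'≡) (cong π₀ (exchange-first l))))) ⟩
      exchange (exchange y)   ≡⟨ exchange-involutive y ⟩
      y                       ∎
      where open ≡-Reasoning

    fromSecond : ∀ l y → π' (e₂ l) ≡ π' y → σ y ≡ ι c
    fromSecond l y π'≡ =
      let l' , e₁l'≡ = S.complete (exchange y) (trans (sym π'≡) (trans (cong π₀ (exchange-second l)) (S.valid l)))
      in subst (λ z → σ z ≡ ι c) (trans (sym (exchange-first l')) (trans (cong exchange e₁l'≡) (exchange-involutive y)))
               (e₂-in-c l')

    π'⊑σ : Refines π' σ
    π'⊑σ x y π'x≡π'y = byPosition (position x) (position y)
      where
      byPosition : Position x → Position y → σ x ≡ σ y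
      byPosition (first  l refl) _               = cong σ (fromFirst l y π'x≡π'y)
      byPosition (second l refl) _               = trans (e₂-in-c l) (sym (fromSecond l y π'x≡π'y))
      byPosition (neither _ _)   (first  l refl) = sym (cong σ (fromFirst l x (sym π'x≡π'y)))
      byPosition (neither _ _)   (second l refl) = trans (fromSecond l x (sym π'x≡π'y)) (sym (e₂-in-c l))
      byPosition (neither x∉₁ x∉₂) (neither y∉₁ y∉₂) =
        π₀⊑σ x y (trans (cong π₀ (sym (exchange-neither x∉₁ x∉₂)))
                        (trans π'x≡π'y (cong π₀ (exchange-neither y∉₁ y∉₂))))

    mergedPair : 2 ≤ at L u → ∃₂ λ a b → a ≢ b × π' a ≡ π' b × σ a ≡ ι c
    mergedPair 2≤u =
      let l , l' , l≢l' = twoDistinct (subst (2 ≤_) (sym (π₀-card u)) 2≤u)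
      in e₂ l , e₂ l' , l≢l' ∘ e₂-injective ,
         trans (cong π₀ (exchange-second l)) (trans (S.valid l) (sym (trans (cong π₀ (exchange-second l')) (S.valid l')))) ,
         e₂-in-c l

  module Merge (u : Fin (length L)) (2≤u : 2 ≤ at L u) (u-fits : ∀ d → 2 ≤ fibreCard σ d → at L u ≤ fibreCard σ d) where

    mergedPairIn : ∀ {i j} → i ≢ j → σ i ≡ σ j →
      Σ (SetPartition (sum L)) λ π → HasType π L × Refines π σ × ∃₂ λ a b → a ≢ b × π a ≡ π b × σ a ≡ σ i
    mergedPairIn {i} {j} i≢j σi≡σj with any? (λ t → (g t Fin.≟ g (segment L i)) ×-dec (2 ≤? at L t))
    ... | yes (t , gt≡c , 2≤t) =
      let a , b , a≢b , π₀a≡ιt , π₀b≡ιt = fibreCard-≥2⁻ π₀ (ι t) (subst (2 ≤_) (sym (π₀-card t)) 2≤t)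
      in π₀ , π₀-type , π₀⊑σ , a , b , a≢b , trans π₀a≡ιt (sym π₀b≡ιt) ,
         trans (cong (ι ∘ g) (ι-injective π₀a≡ιt)) (cong ι gt≡c)
    ... | no no-big-part = Sw.π' , Sw.π'-type , Sw.π'⊑σ , Sw.mergedPair 2≤u
      where
      c = g (segment L i)
      c-singletons : ∀ t → g t ≡ c → at L t ≤ 1
      c-singletons t gt≡c with 2 ≤? at L t
      ... | yes 2≤t = ⊥-elim (no-big-part (t , gt≡c , 2≤t))
      ... | no  2≰t = ≤-pred (≰⇒> 2≰t)
      u∉c : g u ≢ c
      u∉c gu≡c = <⇒≱ 2≤u (c-singletons u gu≡c)
      module Sw = Swap c u u∉c c-singletons
        (subst (_≤ _) (sym (π₀-card u)) (u-fits (σ i) (fibreCard-≥2 σ i≢j refl (sym σi≡σj))))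

    pairPartition : ∀ i j → Σ (SetPartition (sum L)) λ π → (HasType π L × Refines π σ) × (σ i ≡ σ j → π i ≡ π j)
    pairPartition i j with i Fin.≟ j | σ i Fin.≟ σ j
    ... | yes i≡j | _         = π₀ , (π₀-type , π₀⊑σ) , λ _ → cong π₀ i≡j
    ... | no  _   | no  σi≢σj = π₀ , (π₀-type , π₀⊑σ) , λ σi≡σj → ⊥-elim (σi≢σj σi≡σj)
    ... | no  i≢j | yes σi≡σj =
      let π' , π'-type , π'⊑σ , a , b , a≢b , π'a≡π'b , σa≡σi = mergedPairIn i≢j σi≡σj
          π , π-type , π⊑σ , πi≡πj = relocateMergedPair π'-type π'⊑σ a≢b π'a≡π'b σa≡σi σi≡σj i≢j
      in π , (π-type , π⊑σ) , λ _ → πi≡πj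

coarser⇒≼ : ∀ {k μ λ'} → IsPartition k μ → IsPartition k λ' → λ' ≢ ones k →
            Coarser μ λ' → smallestNon1 λ' ≤ smallestNon1 μ → _≼_ {k} μ λ'
coarser⇒≼ {μ = μ} {λ'} (_ , μ>0 , _) λ'-part@(λ'-sorted , λ'>0 , refl) λ'≢ones (g , μ-sorted , μ↭) ς≤ς =
  let πs , πs-ok , merges = pairwiseFamily (λ π → HasType π λ' × Refines π σ) (π₀-type , π₀⊑σ) pairPartition
  in sum λ' * sum λ' , πs , proj₁ ∘ πs-ok , σ , isJoin-intro (proj₂ ∘ πs-ok) merges , σ-type
  where
  open Layout λ' λ'-sorted λ'>0 g
  σ-type : HasType σ μ
  σ-type = μ-sorted , ↭-trans μ↭ (↭-reflexive (trans (coarseSums≡ λ' g) (sym σ-sizes)))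
  ς∈λ' = proj₁ (smallestNon1-partition λ'-part λ'≢ones)
  u = Any.index ς∈λ'
  ς≡u : smallestNon1 λ' ≡ at λ' u
  ς≡u = lookup-index ς∈λ'
  u-fits : ∀ d → 2 ≤ fibreCard σ d → at λ' u ≤ fibreCard σ d
  u-fits d 2≤card = begin
    at λ' u         ≡⟨ sym ς≡u ⟩
    smallestNon1 λ' ≤⟨ ς≤ς ⟩
    smallestNon1 μ  ≤⟨ smallestNon1-≤ μ>0 (fibreCard∈type σ-type d (2≤n⇒n≢0 2≤card)) (2≤n⇒n≢1 2≤card) ⟩
    fibreCard σ d   ∎
    where open ≤-Reasoning
  open Merge u (subst (2 ≤_) ς≡u (proj₂ (smallestNon1-partition λ'-part λ'≢ones))) u-fits

theorem3p4 : (k : ℕ) → 0 < k → (μ λ' : List ℕ) →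
    IsPartition k μ → IsPartition k λ' → μ ≢ ones k → λ' ≢ ones k →
    (_≼_ {k} μ λ' ⇔ (Coarser μ λ' × smallestNon1 μ ≥ smallestNon1 λ'))
theorem3p4 k _ μ λ' μ-part λ'-part@(_ , λ'>0 , _) μ≢ones λ'≢ones = mk⇔
  (λ (_ , πs , πs-types , σ , join , σ-type) →
     refines⇒coarser (proj₁ join zero) (πs-types zero) σ-type ,
     join⇒smallestNon1-≤ μ-part μ≢ones λ'>0 πs-types join σ-type)
  (λ (coarser , ς≤ς) → coarser⇒≼ μ-part λ'-part λ'≢ones coarser ς≤ς)
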